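{- Let $n\ge1$, let $\lambda$ be a partition of an integer $t\le n$ with $l$ parts and $n_i$ parts equal to $i$ ($1\le i\le n$), and let \[ \mu_\lambda(q)=\begin{bmatrix} n+l\\ n_1,n_2,\dots,n_n,n\end{bmatrix}_{q^2}. \] Let $d$ be an even positive divisor of $2n+2$ and $\zeta_d$ a primitive $d$-th root of unity. If $\frac d2$ divides $l$ and $\frac d2$ divides $n_i$ for every $i$, then \[ \mu_\lambda(\zeta_d)=\binom{\frac{2l}{d}}{\frac{2n_1}{d},\frac{2n_2}{d},\dots,\frac{2n_n}{d}}\binom{\frac{2n+2}{d}+\frac{2l}{d}-1}{\frac{2l}{d}}. \]
   Context: $[a]_q=1+q+\dots+q^{a-1}$, $[a]_q!=[1]_q\cdots[a]_q$, $\begin{bmatrix} N\\ a_1,\dots,a_r\end{bmatrix}_q=\frac{[N]_q!}{[a_1]_q!\cdots[a_r]_q!}$ for $\sum a_i=N$; the subscript $q^2$ means substituting $q^2$ for $q$. Unbracketed binomials and multinomials are the ordinary ones. -}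

module Defs where

open import Level using (Level)
open import Data.Nat using (ℕ; zero; suc)
import Data.Nat as N
open import Data.Nat.Combinatorics using (_C_)
open import Data.Fin using (Fin; toℕ)
open import Data.List using (List; []; _∷_; map)
open import Data.Nat.ListAction using (sum)
open import Data.List using (allFin) public
open import Data.Product using (∃)
open import Relation.Nullary using (¬_)
open import Algebra.Bundles using (CommutativeRing)

ΣFin : (n : ℕ) → (Fin n → ℕ) → ℕ
ΣFin n f = sum (map f (allFin n))

multinomial : List ℕ → ℕ
multinomial []       = 1
multinomial (a ∷ as) = ((a N.+ sum as) C a) N.* multinomial as

module _ {c ℓ : Level} (R : CommutativeRing c ℓ) where
  open CommutativeRing R

  pow : Carrier → ℕ → Carrier
  pow x zero    = 1#
  pow x (suc k) = x * pow x k

  fromℕ : ℕ → Carrier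
  fromℕ zero    = 0#
  fromℕ (suc n) = 1# + fromℕ n

  -- Defined by the q-Pascal rule [n+1, k+1] = [n, k] + q^(k+1) [n, k+1],
  -- which is the polynomial equal to [n]_q! / ([k]_q! [n-k]_q!).
  qbinom : Carrier → ℕ → ℕ → Carrier
  qbinom x zero    zero    = 1#
  qbinom x zero    (suc k) = 0#
  qbinom x (suc n) zero    = 1#
  qbinom x (suc n) (suc k) = qbinom x n k + pow x (suc k) * qbinom x n (suc k)

  qmultinomial : Carrier → List ℕ → Carrier
  qmultinomial x []       = 1#
  qmultinomial x (a ∷ as) = qbinom x (a N.+ sum as) a * qmultinomial x as

  IsFieldR : Set (c Level.⊔ ℓ)
  IsFieldR = (¬ (1# ≈ 0#)) Data.Product.× (∀ x → ¬ (x ≈ 0#) → ∃ λ y → x * y ≈ 1#)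

  CharZero : Set ℓ
  CharZero = ∀ m → ¬ (fromℕ (suc m) ≈ 0#)

  PrimitiveRoot : ℕ → Carrier → Set ℓ
  PrimitiveRoot d ζ = (pow ζ d ≈ 1#) Data.Product.× (∀ k → 0 N.< k → k N.< d → ¬ (pow ζ k ≈ 1#))

{-# OPTIONS --safe #-}
module Submission where

-- With d = 2e, q = ζ² is a primitive e-th root of unity and n + 1 = (b + 1) e, so n = b e + (e - 1).
-- In a field, [e choose k]_q = 0 for 0 < k < e, because [k]_q [e choose k]_q = [e]_q [e-1 choose k-1]_q
-- with [e]_q = 0 and [k]_q ≠ 0.  Hence the q-Pascal rule makes [N + e choose K]_q agree with
-- [N choose K]_q + [N choose K - e]_q, which yields the q-Lucas theorem
-- [a e + r choose b e]_q = (a choose b) for r < e.  With n_i = y_i e, every factor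
-- [n_i + … + n_n + n choose n_i]_q of the q-multinomial has this shape, so it evaluates to the
-- multinomial (y_1 + … + y_n + b; y_1, …, y_n, b), from which the binomial
-- (b + Σ y choose Σ y) splits off.

open import Level using (Level)
open import Function using (_∘_)
open import Data.Nat as ℕ using (ℕ; zero; suc; pred; _<_; z<s; s<s; s≤s; z≤n; NonZero; >-nonZero⁻¹)
import Data.Nat.Properties as ℕ
open import Data.Nat.Combinatorics using (_C_; nCk+nC[k+1]≡[n+1]C[k+1]; k>n⇒nCk≡0)
open import Data.Nat.ListAction using (sum)
open import Data.List using (List; []; _∷_; map; _++_; [_])
open import Data.Product using (_,_; proj₁; proj₂; ∃-syntax)
open import Relation.Nullary using (¬_)
import Relation.Binary.PropositionalEquality as ≡
import Algebra.Properties.CommutativeSemigroup ℕ.+-commutativeSemigroup as ℕ-+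
open import Algebra.Bundles using (CommutativeRing)
open import Defs

module Multinomial where

  open import Data.Nat using (_+_; _*_; _∸_; _!; _≤_)
  open import Data.Nat.Properties
  open import Data.Nat.Combinatorics using (nCk≡n!/k![n-k]!; k![n∸k]!∣n!; nCn≡1)
  open import Data.Nat.DivMod using (m/n*n≡m)
  open import Data.Nat.ListAction.Properties using (sum-++)
  open import Data.Nat.Tactic.RingSolver using (solve-∀)
  open import Algebra.Properties.CommutativeSemigroup *-commutativeSemigroup using (x∙yz≈y∙xz)
  open ≡ using (_≡_; refl; sym; trans; cong; cong₂; module ≡-Reasoning)

  nCk*k![n∸k]!≡n! : ∀ {n k} → k ≤ n → (n C k) * (k ! * (n ∸ k) !) ≡ n !
  nCk*k![n∸k]!≡n! {n} {k} k≤n =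
    trans (cong (_* (k ! * (n ∸ k) !)) (nCk≡n!/k![n-k]! k≤n)) (m/n*n≡m {{_}} (k![n∸k]!∣n! k≤n))

  [a+b]Ca*a!*b!≡[a+b]! : ∀ a b → ((a + b) C a) * (a ! * b !) ≡ (a + b) !
  [a+b]Ca*a!*b!≡[a+b]! a b =
    trans (cong (λ t → ((a + b) C a) * (a ! * t !)) (sym (m+n∸m≡n a b))) (nCk*k![n∸k]!≡n! (m≤m+n a b))

  -- Both sides equal (a + b + c)! / (a! b! c!).
  trinomial-split : ∀ a b c →
    ((a + (b + c)) C a) * ((b + c) C b) ≡ ((a + b) C a) * ((a + b + c) C (a + b))
  trinomial-split a b c = *-cancelʳ-≡ _ _ (a ! * (b ! * c !)) {{a!b!c!≢0}} (trans lhs (sym rhs))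
    where
      open ≡-Reasoning
      a!b!c!≢0 : NonZero (a ! * (b ! * c !))
      a!b!c!≢0 = m*n≢0 (a !) (b ! * c !) {{a !≢0}} {{b !* c !≢0}}
      shuffleˡ : ∀ x y u v w → x * y * (u * (v * w)) ≡ x * (u * (y * (v * w)))
      shuffleˡ = solve-∀
      shuffleʳ : ∀ x y u v w → x * y * (u * (v * w)) ≡ y * (x * (u * v) * w)
      shuffleʳ = solve-∀
      lhs : ((a + (b + c)) C a) * ((b + c) C b) * (a ! * (b ! * c !)) ≡ (a + (b + c)) !
      lhs = begin
        ((a + (b + c)) C a) * ((b + c) C b) * (a ! * (b ! * c !))
          ≡⟨ shuffleˡ ((a + (b + c)) C a) ((b + c) C b) (a !) (b !) (c !) ⟩
        ((a + (b + c)) C a) * (a ! * (((b + c) C b) * (b ! * c !)))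
          ≡⟨ cong (λ t → ((a + (b + c)) C a) * (a ! * t)) ([a+b]Ca*a!*b!≡[a+b]! b c) ⟩
        ((a + (b + c)) C a) * (a ! * (b + c) !)
          ≡⟨ [a+b]Ca*a!*b!≡[a+b]! a (b + c) ⟩
        (a + (b + c)) !
          ∎
      rhs : ((a + b) C a) * ((a + b + c) C (a + b)) * (a ! * (b ! * c !)) ≡ (a + (b + c)) !
      rhs = begin
        ((a + b) C a) * ((a + b + c) C (a + b)) * (a ! * (b ! * c !))
          ≡⟨ shuffleʳ ((a + b) C a) ((a + b + c) C (a + b)) (a !) (b !) (c !) ⟩
        ((a + b + c) C (a + b)) * (((a + b) C a) * (a ! * b !) * c !)
          ≡⟨ cong (λ t → ((a + b + c) C (a + b)) * (t * c !)) ([a+b]Ca*a!*b!≡[a+b]! a b) ⟩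
        ((a + b + c) C (a + b)) * ((a + b) ! * c !)
          ≡⟨ [a+b]Ca*a!*b!≡[a+b]! (a + b) c ⟩
        (a + b + c) !
          ≡⟨ cong _! (+-assoc a b c) ⟩
        (a + (b + c)) !
          ∎

  multinomial-∷ʳ : ∀ ys b → multinomial (ys ++ [ b ]) ≡ multinomial ys * ((sum ys + b) C sum ys)
  multinomial-∷ʳ [] b = trans (cong (λ t → (t C b) * 1) (+-identityʳ b)) (cong (_* 1) (nCn≡1 b))
  multinomial-∷ʳ (y ∷ ys) b = begin
    ((y + sum (ys ++ [ b ])) C y) * multinomial (ys ++ [ b ])
      ≡⟨ cong₂ (λ s t → ((y + s) C y) * t) sum-ys∷ʳb (multinomial-∷ʳ ys b) ⟩
    ((y + (S + b)) C y) * (M * ((S + b) C S))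
      ≡⟨ x∙yz≈y∙xz ((y + (S + b)) C y) M ((S + b) C S) ⟩
    M * (((y + (S + b)) C y) * ((S + b) C S))
      ≡⟨ cong (M *_) (trinomial-split y S b) ⟩
    M * (((y + S) C y) * ((y + S + b) C (y + S)))
      ≡⟨ x∙yz≈y∙xz ((y + S) C y) M ((y + S + b) C (y + S)) ⟨
    ((y + S) C y) * (M * ((y + S + b) C (y + S)))
      ≡⟨ *-assoc ((y + S) C y) M ((y + S + b) C (y + S)) ⟨
    ((y + S) C y) * M * ((y + S + b) C (y + S))
      ∎
    where
      open ≡-Reasoning
      S M : ℕ
      S = sum ys
      M = multinomial ys
      sum-ys∷ʳb : sum (ys ++ [ b ]) ≡ S + b
      sum-ys∷ʳb = trans (sum-++ ys [ b ]) (cong (S +_) (+-identityʳ b))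

  sum-map-*ʳ : ∀ e ys → sum (map (_* e) ys) ≡ sum ys * e
  sum-map-*ʳ e [] = refl
  sum-map-*ʳ e (y ∷ ys) = trans (cong (y * e +_) (sum-map-*ʳ e ys)) (sym (*-distribʳ-+ e y (sum ys)))

  sum-map-*ʳ-∷ʳ : ∀ e r ys b → sum (map (_* e) ys ++ [ b * e + r ]) ≡ sum (ys ++ [ b ]) * e + r
  sum-map-*ʳ-∷ʳ e r [] b =
    trans (+-identityʳ (b * e + r)) (cong (λ t → t * e + r) (sym (+-identityʳ b)))
  sum-map-*ʳ-∷ʳ e r (y ∷ ys) b = begin
    y * e + sum (map (_* e) ys ++ [ b * e + r ])  ≡⟨ cong (y * e +_) (sum-map-*ʳ-∷ʳ e r ys b) ⟩
    y * e + (T * e + r)                           ≡⟨ +-assoc (y * e) (T * e) r ⟨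
    y * e + T * e + r                             ≡⟨ cong (_+ r) (*-distribʳ-+ e y T) ⟨
    (y + T) * e + r                               ∎
    where
      open ≡-Reasoning
      T : ℕ
      T = sum (ys ++ [ b ])

open Multinomial

pred[n]<n : ∀ {n} .{{_ : NonZero n}} → pred n < n
pred[n]<n = ℕ.m≤pred[n]⇒suc[m]≤n ℕ.≤-refl

module _ {c ℓ : Level} (K : CommutativeRing c ℓ) where

  open CommutativeRing K hiding (zero)
  open import Relation.Binary.Reasoning.Setoid setoid
  open import Algebra.Properties.Ring ring using (x∙y⁻¹≈ε⇒x≈y; x≈y⇒x∙y⁻¹≈ε; x[y-z]≈xy-xz; +-cancelʳ)
  open import Algebra.Properties.CommutativeSemigroup *-commutativeSemigroup using (interchange)
  open import Algebra.Solver.Ring.NaturalCoefficients.Default commutativeSemiring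

  private
    infixr 8 _^_
    _^_ : Carrier → ℕ → Carrier
    _^_ = pow K

  ^-homo-+ : ∀ x m n → x ^ (m ℕ.+ n) ≈ x ^ m * x ^ n
  ^-homo-+ x zero    n = sym (*-identityˡ _)
  ^-homo-+ x (suc m) n = trans (*-congˡ (^-homo-+ x m n)) (sym (*-assoc _ _ _))

  ^-distrib-* : ∀ x y n → (x * y) ^ n ≈ x ^ n * y ^ n
  ^-distrib-* x y zero    = sym (*-identityˡ 1#)
  ^-distrib-* x y (suc n) = trans (*-congˡ (^-distrib-* x y n)) (interchange x y _ _)

  fromℕ-homo-+ : ∀ m n → fromℕ K (m ℕ.+ n) ≈ fromℕ K m + fromℕ K n
  fromℕ-homo-+ zero    n = sym (+-identityˡ _)
  fromℕ-homo-+ (suc m) n = trans (+-congˡ (fromℕ-homo-+ m n)) (sym (+-assoc _ _ _))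

  fromℕ-homo-* : ∀ m n → fromℕ K (m ℕ.* n) ≈ fromℕ K m * fromℕ K n
  fromℕ-homo-* zero    n = sym (zeroˡ _)
  fromℕ-homo-* (suc m) n = begin
    fromℕ K (n ℕ.+ m ℕ.* n)                 ≈⟨ fromℕ-homo-+ n (m ℕ.* n) ⟩
    fromℕ K n + fromℕ K (m ℕ.* n)           ≈⟨ +-cong (sym (*-identityˡ _)) (fromℕ-homo-* m n) ⟩
    1# * fromℕ K n + fromℕ K m * fromℕ K n  ≈⟨ distribʳ _ _ _ ⟨
    (1# + fromℕ K m) * fromℕ K n            ∎

  [x*x]^k≈x^[2*k] : ∀ x k → (x * x) ^ k ≈ x ^ (2 ℕ.* k)
  [x*x]^k≈x^[2*k] x k = begin
    (x * x) ^ k    ≈⟨ ^-distrib-* x x k ⟩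
    x ^ k * x ^ k  ≈⟨ ^-homo-+ x k k ⟨
    x ^ (k ℕ.+ k)  ≡⟨ ≡.cong (λ j → x ^ (k ℕ.+ j)) (ℕ.+-identityʳ k) ⟨
    x ^ (2 ℕ.* k)  ∎

  PrimitiveRoot-square : ∀ e ζ → PrimitiveRoot K (2 ℕ.* e) ζ → PrimitiveRoot K e (ζ * ζ)
  PrimitiveRoot-square e ζ (ζ^2e≈1 , ζ-primitive) =
    trans ([x*x]^k≈x^[2*k] ζ e) ζ^2e≈1 ,
    λ k 0<k k<e → ζ-primitive (2 ℕ.* k) (ℕ.*-monoʳ-< 2 0<k) (ℕ.*-monoʳ-< 2 k<e)
                  ∘ trans (sym ([x*x]^k≈x^[2*k] ζ k))

  module Field (isField : IsFieldR K) where

    x*y≈0⇒x≈0 : ∀ {x y} → ¬ y ≈ 0# → x * y ≈ 0# → x ≈ 0#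
    x*y≈0⇒x≈0 {x} {y} y≉0 xy≈0 = begin
      x              ≈⟨ *-identityʳ x ⟨
      x * 1#         ≈⟨ *-congˡ yy⁻¹≈1 ⟨
      x * (y * y⁻¹)  ≈⟨ *-assoc x y y⁻¹ ⟨
      x * y * y⁻¹    ≈⟨ *-congʳ xy≈0 ⟩
      0# * y⁻¹       ≈⟨ zeroˡ y⁻¹ ⟩
      0#             ∎
      where
        y⁻¹ : Carrier
        y⁻¹ = proj₁ (proj₂ isField y y≉0)
        yy⁻¹≈1 : y * y⁻¹ ≈ 1#
        yy⁻¹≈1 = proj₂ (proj₂ isField y y≉0)

    x*y≈x*z⇒x≈0 : ∀ {x y z} → ¬ y ≈ z → x * y ≈ x * z → x ≈ 0#
    x*y≈x*z⇒x≈0 {x} {y} {z} y≉z xy≈xz =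
      x*y≈0⇒x≈0 (y≉z ∘ x∙y⁻¹≈ε⇒x≈y y z) (trans (x[y-z]≈xy-xz x y z) (x≈y⇒x∙y⁻¹≈ε xy≈xz))

  module QBinomial (q : Carrier) where

    [_]q : ℕ → Carrier
    [ zero  ]q = 0#
    [ suc m ]q = 1# + q * [ m ]q

    [_choose_]q : ℕ → ℕ → Carrier
    [ n choose k ]q = qbinom K q n k

    qbinom-zeroʳ : ∀ n → [ n choose 0 ]q ≈ 1#
    qbinom-zeroʳ zero    = refl
    qbinom-zeroʳ (suc n) = refl

    qbinom-> : ∀ {n k} → n < k → [ n choose k ]q ≈ 0#
    qbinom-> {zero}  {suc k} _         = refl
    qbinom-> {suc n} {suc k} (s<s n<k) = begin
      [ n choose k ]q + q ^ suc k * [ n choose suc k ]q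
        ≈⟨ +-cong (qbinom-> n<k) (*-congˡ (qbinom-> (ℕ.m<n⇒m<1+n n<k))) ⟩
      0# + q ^ suc k * 0#   ≈⟨ +-identityˡ _ ⟩
      q ^ suc k * 0#        ≈⟨ zeroʳ _ ⟩
      0#                    ∎

    qbinom-diag : ∀ n → [ n choose n ]q ≈ 1#
    qbinom-diag zero    = refl
    qbinom-diag (suc n) = begin
      [ n choose n ]q + q ^ suc n * [ n choose suc n ]q
        ≈⟨ +-cong (qbinom-diag n) (*-congˡ (qbinom-> (ℕ.n<1+n n))) ⟩
      1# + q ^ suc n * 0#   ≈⟨ +-congˡ (zeroʳ _) ⟩
      1# + 0#               ≈⟨ +-identityʳ 1# ⟩
      1#                    ∎

    qbinom-pascal : ∀ n k .{{_ : NonZero k}} →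
                    [ suc n choose k ]q ≈ [ n choose pred k ]q + q ^ k * [ n choose k ]q
    qbinom-pascal n (suc k) = refl

    qbinom-one : ∀ n → [ n choose 1 ]q ≈ [ n ]q
    qbinom-one zero    = refl
    qbinom-one (suc n) = +-cong (qbinom-zeroʳ n) (*-cong (*-identityʳ q) (qbinom-one n))

    [m]q*q+1≈[m]q+q^m : ∀ m → [ m ]q * q + 1# ≈ [ m ]q + q ^ m
    [m]q*q+1≈[m]q+q^m zero    = +-congʳ (zeroˡ q)
    [m]q*q+1≈[m]q+q^m (suc m) = begin
      (1# + q * [ m ]q) * q + 1#
        ≈⟨ solve 2 (λ q i → (con 1 :+ q :* i) :* q :+ con 1 := q :* (i :* q :+ con 1) :+ con 1)
                 refl q [ m ]q ⟩
      q * ([ m ]q * q + 1#) + 1#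
        ≈⟨ +-congʳ (*-congˡ ([m]q*q+1≈[m]q+q^m m)) ⟩
      q * ([ m ]q + q ^ m) + 1#
        ≈⟨ solve 3 (λ q i p → q :* (i :+ p) :+ con 1 := (con 1 :+ q :* i) :+ q :* p)
                 refl q [ m ]q (q ^ m) ⟩
      (1# + q * [ m ]q) + q * q ^ m
        ∎

    [1+k]q*qbinom≈[1+n]q*qbinom : ∀ n k →
      [ suc k ]q * [ suc n choose suc k ]q ≈ [ suc n ]q * [ n choose k ]q
    [1+k]q*qbinom≈[1+n]q*qbinom n zero = begin
      [ 1 ]q * [ suc n choose 1 ]q  ≈⟨ *-cong [1]q≈1 (qbinom-one (suc n)) ⟩
      1# * [ suc n ]q               ≈⟨ *-identityˡ _ ⟩
      [ suc n ]q                    ≈⟨ *-identityʳ _ ⟨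
      [ suc n ]q * 1#               ≈⟨ *-congˡ (qbinom-zeroʳ n) ⟨
      [ suc n ]q * [ n choose 0 ]q  ∎
      where
        [1]q≈1 : [ 1 ]q ≈ 1#
        [1]q≈1 = trans (+-congˡ (zeroʳ q)) (+-identityʳ 1#)
    [1+k]q*qbinom≈[1+n]q*qbinom zero (suc k) =
      trans (*-congˡ (qbinom-> {1} {suc (suc k)} (s<s z<s))) (trans (zeroʳ _) (sym (zeroʳ _)))
    [1+k]q*qbinom≈[1+n]q*qbinom (suc n) (suc k) = begin
      (1# + q * I) * (X + p * Y + (q * p) * Z)
        ≈⟨ solve 6 (λ q I X Y p Z → (con 1 :+ q :* I) :* (X :+ p :* Y :+ (q :* p) :* Z)
                   := (X :+ p :* Y) :+ q :* (I :* (X :+ p :* Y)) :+ (q :* p) :* ((con 1 :+ q :* I) :* Z))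
                   refl q I X Y p Z ⟩
      (X + p * Y) + q * (I * (X + p * Y)) + (q * p) * ((1# + q * I) * Z)
        ≈⟨ +-cong (+-congˡ (*-congˡ ([1+k]q*qbinom≈[1+n]q*qbinom n k)))
                  (*-congˡ ([1+k]q*qbinom≈[1+n]q*qbinom n (suc k))) ⟩
      (X + p * Y) + q * (J * X) + (q * p) * (J * Y)
        ≈⟨ solve 5 (λ q J X Y p → (X :+ p :* Y) :+ q :* (J :* X) :+ (q :* p) :* (J :* Y)
                   := (con 1 :+ q :* J) :* (X :+ p :* Y))
                   refl q J X Y p ⟩
      (1# + q * J) * (X + p * Y)  ∎
      where
        I J X Y Z p : Carrier
        I = [ suc k ]q
        J = [ suc n ]q
        X = [ n choose k ]q
        Y = [ n choose suc k ]q
        Z = [ suc n choose suc (suc k) ]q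
        p = q ^ suc k

  module RootOfUnity (isField : IsFieldR K) (e : ℕ) .{{_ : NonZero e}}
                     (q : Carrier) (q-primitive : PrimitiveRoot K e q) where

    open Field isField
    open QBinomial q

    private
      q^e≈1 : q ^ e ≈ 1#
      q^e≈1 = proj₁ q-primitive

      q^[j+e]≈q^j : ∀ j → q ^ (j ℕ.+ e) ≈ q ^ j
      q^[j+e]≈q^j j = trans (^-homo-+ q j e) (trans (*-congˡ q^e≈1) (*-identityʳ _))

    [k]q≉0 : ∀ {k} → 0 < k → k < e → ¬ [ k ]q ≈ 0#
    [k]q≉0 {k} 0<k k<e [k]q≈0 = proj₂ q-primitive k 0<k k<e (begin
      q ^ k               ≈⟨ +-identityˡ _ ⟨
      0# + q ^ k          ≈⟨ +-congʳ [k]q≈0 ⟨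
      [ k ]q + q ^ k      ≈⟨ [m]q*q+1≈[m]q+q^m k ⟨
      [ k ]q * q + 1#     ≈⟨ +-congʳ (trans (*-congʳ [k]q≈0) (zeroˡ q)) ⟩
      0# + 1#             ≈⟨ +-identityˡ 1# ⟩
      1#                  ∎)

    [e]q≈0 : 1 < e → [ e ]q ≈ 0#
    [e]q≈0 1<e = x*y≈x*z⇒x≈0 q≉1 (trans [e]q*q≈[e]q (sym (*-identityʳ _)))
      where
        q≉1 : ¬ q ≈ 1#
        q≉1 = proj₂ q-primitive 1 z<s 1<e ∘ trans (*-identityʳ q)
        [e]q*q≈[e]q : [ e ]q * q ≈ [ e ]q
        [e]q*q≈[e]q = +-cancelʳ 1# _ _ (trans ([m]q*q+1≈[m]q+q^m e) (+-congˡ q^e≈1))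

    qbinom-e≈0 : ∀ {k} → 0 < k → k < e → [ e choose k ]q ≈ 0#
    qbinom-e≈0 {suc k} 0<k k<e = x*y≈0⇒x≈0 ([k]q≉0 0<k k<e) (begin
      [ e choose suc k ]q * [ suc k ]q
        ≈⟨ *-comm _ _ ⟩
      [ suc k ]q * [ e choose suc k ]q
        ≡⟨ ≡.cong (λ n → [ suc k ]q * [ n choose suc k ]q) (ℕ.suc-pred e) ⟨
      [ suc k ]q * [ suc (pred e) choose suc k ]q
        ≈⟨ [1+k]q*qbinom≈[1+n]q*qbinom (pred e) k ⟩
      [ suc (pred e) ]q * [ pred e choose k ]q
        ≡⟨ ≡.cong (λ n → [ n ]q * [ pred e choose k ]q) (ℕ.suc-pred e) ⟩
      [ e ]q * [ pred e choose k ]q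
        ≈⟨ *-congʳ ([e]q≈0 (ℕ.≤-<-trans (s≤s z≤n) k<e)) ⟩
      0# * [ pred e choose k ]q
        ≈⟨ zeroˡ _ ⟩
      0#
        ∎)

    qbinom-+e-below : ∀ n {k} → k < e → [ n ℕ.+ e choose k ]q ≈ [ n choose k ]q
    qbinom-+e-below zero    {zero}  _   = qbinom-zeroʳ e
    qbinom-+e-below zero    {suc k} k<e = qbinom-e≈0 z<s k<e
    qbinom-+e-below (suc n) {zero}  _   = refl
    qbinom-+e-below (suc n) {suc k} k<e =
      +-cong (qbinom-+e-below n (ℕ.<-trans (ℕ.n<1+n k) k<e)) (*-congˡ (qbinom-+e-below n k<e))

    qbinom-+e-above : ∀ n k →
                      [ n ℕ.+ e choose k ℕ.+ e ]q ≈ [ n choose k ℕ.+ e ]q + [ n choose k ]q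
    qbinom-+e-above zero zero = begin
      [ e choose e ]q            ≈⟨ qbinom-diag e ⟩
      1#                         ≈⟨ +-identityˡ 1# ⟨
      0# + 1#                    ≈⟨ +-congʳ (qbinom-> (>-nonZero⁻¹ e)) ⟨
      [ 0 choose e ]q + 1#       ∎
    qbinom-+e-above zero (suc k) =
      trans (qbinom-> (ℕ.m<n+m e z<s)) (sym (+-identityʳ 0#))
    qbinom-+e-above (suc n) zero = begin
      [ suc (n ℕ.+ e) choose e ]q
        ≈⟨ qbinom-pascal (n ℕ.+ e) e ⟩
      [ n ℕ.+ e choose pred e ]q + q ^ e * [ n ℕ.+ e choose e ]q
        ≈⟨ +-cong (qbinom-+e-below n pred[n]<n) (*-congˡ (qbinom-+e-above n zero)) ⟩
      [ n choose pred e ]q + q ^ e * ([ n choose e ]q + [ n choose 0 ]q)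
        ≈⟨ solve 4 (λ a p x y → a :+ p :* (x :+ y) := (a :+ p :* x) :+ p :* y) refl _ (q ^ e) _ _ ⟩
      ([ n choose pred e ]q + q ^ e * [ n choose e ]q) + q ^ e * [ n choose 0 ]q
        ≈⟨ +-cong (qbinom-pascal n e) (sym (trans (*-cong q^e≈1 (qbinom-zeroʳ n)) (*-identityˡ 1#)))
         ⟨
      [ suc n choose e ]q + 1#   ∎
    qbinom-+e-above (suc n) (suc k) = begin
      [ n ℕ.+ e choose k ℕ.+ e ]q + q ^ suc (k ℕ.+ e) * [ n ℕ.+ e choose suc k ℕ.+ e ]q
        ≈⟨ +-cong (qbinom-+e-above n k) (*-congˡ (qbinom-+e-above n (suc k))) ⟩
      ([ n choose k ℕ.+ e ]q + [ n choose k ]q)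
        + q ^ suc (k ℕ.+ e) * ([ n choose suc k ℕ.+ e ]q + [ n choose suc k ]q)
        ≈⟨ solve 5 (λ a b c d p → (a :+ b) :+ p :* (c :+ d) := (a :+ p :* c) :+ (b :+ p :* d))
                 refl _ _ _ _ _ ⟩
      ([ n choose k ℕ.+ e ]q + q ^ suc (k ℕ.+ e) * [ n choose suc k ℕ.+ e ]q)
        + ([ n choose k ]q + q ^ suc (k ℕ.+ e) * [ n choose suc k ]q)
        ≈⟨ +-congˡ (+-congˡ (*-congʳ (q^[j+e]≈q^j (suc k)))) ⟩
      [ suc n choose suc k ℕ.+ e ]q + [ suc n choose suc k ]q  ∎

    q-Lucas : ∀ {r} → r < e → ∀ a b → [ a ℕ.* e ℕ.+ r choose b ℕ.* e ]q ≈ fromℕ K (a C b)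
    q-Lucas {r} r<e zero    zero    = trans (qbinom-zeroʳ r) (sym (+-identityʳ 1#))
    q-Lucas {r} r<e zero    (suc b) = begin
      [ r choose suc b ℕ.* e ]q   ≈⟨ qbinom-> (ℕ.<-≤-trans r<e (ℕ.m≤m+n e (b ℕ.* e))) ⟩
      0#                          ≡⟨ ≡.cong (fromℕ K) (k>n⇒nCk≡0 {0} {suc b} z<s) ⟨
      fromℕ K (0 C suc b)         ∎
    q-Lucas {r} r<e (suc a) zero    = trans (qbinom-zeroʳ (suc a ℕ.* e ℕ.+ r)) (sym (+-identityʳ 1#))
    q-Lucas {r} r<e (suc a) (suc b) = begin
      [ suc a ℕ.* e ℕ.+ r choose suc b ℕ.* e ]q
        ≡⟨ ≡.cong₂ [_choose_]q (ℕ-+.xy∙z≈yz∙x e (a ℕ.* e) r) (ℕ.+-comm e (b ℕ.* e)) ⟩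
      [ a ℕ.* e ℕ.+ r ℕ.+ e choose b ℕ.* e ℕ.+ e ]q
        ≈⟨ qbinom-+e-above (a ℕ.* e ℕ.+ r) (b ℕ.* e) ⟩
      [ a ℕ.* e ℕ.+ r choose b ℕ.* e ℕ.+ e ]q + [ a ℕ.* e ℕ.+ r choose b ℕ.* e ]q
        ≡⟨ ≡.cong (λ j → [ a ℕ.* e ℕ.+ r choose j ]q + [ a ℕ.* e ℕ.+ r choose b ℕ.* e ]q)
                  (ℕ.+-comm (b ℕ.* e) e) ⟩
      [ a ℕ.* e ℕ.+ r choose suc b ℕ.* e ]q + [ a ℕ.* e ℕ.+ r choose b ℕ.* e ]q
        ≈⟨ +-cong (q-Lucas r<e a (suc b)) (q-Lucas r<e a b) ⟩
      fromℕ K (a C suc b) + fromℕ K (a C b)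
        ≈⟨ +-comm _ _ ⟩
      fromℕ K (a C b) + fromℕ K (a C suc b)
        ≈⟨ fromℕ-homo-+ (a C b) (a C suc b) ⟨
      fromℕ K (a C b ℕ.+ a C suc b)
        ≡⟨ ≡.cong (fromℕ K) (nCk+nC[k+1]≡[n+1]C[k+1] a b) ⟩
      fromℕ K (suc a C suc b)     ∎

    qmultinomial-at-root : ∀ {r} → r < e → ∀ ys b →
      qmultinomial K q (map (ℕ._* e) ys ++ [ b ℕ.* e ℕ.+ r ]) ≈ fromℕ K (multinomial (ys ++ [ b ]))
    qmultinomial-at-root {r} r<e [] b = begin
      [ b ℕ.* e ℕ.+ r ℕ.+ 0 choose b ℕ.* e ℕ.+ r ]q * 1#
        ≈⟨ *-identityʳ _ ⟩
      [ b ℕ.* e ℕ.+ r ℕ.+ 0 choose b ℕ.* e ℕ.+ r ]q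
        ≡⟨ ≡.cong [_choose b ℕ.* e ℕ.+ r ]q (ℕ.+-identityʳ (b ℕ.* e ℕ.+ r)) ⟩
      [ b ℕ.* e ℕ.+ r choose b ℕ.* e ℕ.+ r ]q
        ≈⟨ qbinom-diag (b ℕ.* e ℕ.+ r) ⟩
      1#
        ≈⟨ +-identityʳ 1# ⟨
      fromℕ K 1
        ≡⟨ ≡.cong (fromℕ K) (multinomial-∷ʳ [] b) ⟨
      fromℕ K (multinomial [ b ]) ∎
    qmultinomial-at-root {r} r<e (y ∷ ys) b = begin
      [ y ℕ.* e ℕ.+ sum rest choose y ℕ.* e ]q * qmultinomial K q rest
        ≡⟨ ≡.cong (λ n → [ n choose y ℕ.* e ]q * qmultinomial K q rest)
                  (sum-map-*ʳ-∷ʳ e r (y ∷ ys) b) ⟩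
      [ (y ℕ.+ T) ℕ.* e ℕ.+ r choose y ℕ.* e ]q * qmultinomial K q rest
        ≈⟨ *-cong (q-Lucas r<e (y ℕ.+ T) y) (qmultinomial-at-root r<e ys b) ⟩
      fromℕ K ((y ℕ.+ T) C y) * fromℕ K (multinomial (ys ++ [ b ]))
        ≈⟨ fromℕ-homo-* ((y ℕ.+ T) C y) (multinomial (ys ++ [ b ])) ⟨
      fromℕ K (multinomial (y ∷ ys ++ [ b ])) ∎
      where
        rest : List ℕ
        rest = map (ℕ._* e) ys ++ [ b ℕ.* e ℕ.+ r ]
        T : ℕ
        T = sum (ys ++ [ b ])

open import Data.Nat using (_+_; _*_; _∸_; _≤_; _/_)
open import Data.Nat.Divisibility using (_∣_; divides; *-cancelˡ-∣)
open import Data.Nat.DivMod using (m/n*n≡m; m*n/n≡m)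
open import Data.Fin using (Fin; toℕ)
open import Data.List.Properties using (map-cong; map-∘)
open ≡ using (_≡_)

2e∣2n+2⇒1+n≡[1+b]*e : ∀ n e .{{_ : NonZero e}} → 2 * e ∣ 2 * n + 2 → ∃[ b ] suc n ≡ suc b * e
2e∣2n+2⇒1+n≡[1+b]*e n e 2e∣2n+2 = quotient (*-cancelˡ-∣ 2 (≡.subst (2 * e ∣_) 2n+2≡2[1+n] 2e∣2n+2))
  where
    2n+2≡2[1+n] : 2 * n + 2 ≡ 2 * suc n
    2n+2≡2[1+n] = ≡.trans (≡.sym (ℕ.*-distribˡ-+ 2 n 1)) (≡.cong (2 *_) (ℕ.+-comm n 1))
    quotient : e ∣ suc n → ∃[ b ] suc n ≡ suc b * e
    quotient (divides (suc b) 1+n≡[1+b]*e) = b , 1+n≡[1+b]*e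

pred[[1+b]*e]≡b*e+pred[e] : ∀ b e .{{_ : NonZero e}} → pred (suc b * e) ≡ b * e + pred e
pred[[1+b]*e]≡b*e+pred[e] b (suc e) = ℕ.+-comm e (b * suc e)

lemma6p3 : {c ℓ : Level} (K : CommutativeRing c ℓ) → IsFieldR K → CharZero K →
    (n : ℕ) → 1 ≤ n →
    (m : Fin n → ℕ) → ΣFin n (λ i → suc (toℕ i) * m i) ≤ n →
    (e : ℕ) → .{{_ : NonZero e}} → (2 * e) ∣ (2 * n + 2) →
    (ζ : CommutativeRing.Carrier K) → PrimitiveRoot K (2 * e) ζ →
    e ∣ ΣFin n m → (∀ i → e ∣ m i) →
    CommutativeRing._≈_ K
      (qmultinomial K (CommutativeRing._*_ K ζ ζ) (map m (allFin n) ++ [ n ]))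
      (fromℕ K (multinomial (map (λ i → m i / e) (allFin n))
                * (((n + 1) / e + ΣFin n m / e ∸ 1) C (ΣFin n m / e))))
lemma6p3 K isField _ n _ m _ e 2e∣2n+2 ζ ζ-primitive _ e∣m
  with b , 1+n≡[1+b]*e ← 2e∣2n+2⇒1+n≡[1+b]*e n e 2e∣2n+2 = begin
  qmultinomial K (ζ *ᴷ ζ) (map m (allFin n) ++ [ n ])
    ≡⟨ ≡.cong₂ (λ xs k → qmultinomial K (ζ *ᴷ ζ) (xs ++ [ k ])) ms≡ys*e n≡b*e+pred[e] ⟩
  qmultinomial K (ζ *ᴷ ζ) (map (_* e) ys ++ [ b * e + pred e ])
    ≈⟨ qmultinomial-at-root pred[n]<n ys b ⟩
  fromℕ K (multinomial (ys ++ [ b ]))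
    ≡⟨ ≡.cong (fromℕ K) (≡.trans (multinomial-∷ʳ ys b) (≡.cong (multinomial ys *_) binomial-factor)) ⟩
  fromℕ K (multinomial ys * (((n + 1) / e + ΣFin n m / e ∸ 1) C (ΣFin n m / e))) ∎
  where
    open CommutativeRing K using (setoid) renaming (_*_ to _*ᴷ_)
    open import Relation.Binary.Reasoning.Setoid setoid
    open RootOfUnity K isField e (ζ *ᴷ ζ) (PrimitiveRoot-square K e ζ ζ-primitive)
    ys : List ℕ
    ys = map (λ i → m i / e) (allFin n)
    n≡b*e+pred[e] : n ≡ b * e + pred e
    n≡b*e+pred[e] = ≡.trans (≡.cong pred 1+n≡[1+b]*e) (pred[[1+b]*e]≡b*e+pred[e] b e)
    [n+1]/e≡1+b : (n + 1) / e ≡ suc b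
    [n+1]/e≡1+b = ≡.trans (≡.cong (_/ e) (≡.trans (ℕ.+-comm n 1) 1+n≡[1+b]*e)) (m*n/n≡m (suc b) e)
    ms≡ys*e : map m (allFin n) ≡ map (_* e) ys
    ms≡ys*e = ≡.trans (map-cong (λ i → ≡.sym (m/n*n≡m (e∣m i))) (allFin n)) (map-∘ (allFin n))
    Σm/e≡Σys : ΣFin n m / e ≡ sum ys
    Σm/e≡Σys = ≡.trans (≡.cong (λ xs → sum xs / e) ms≡ys*e)
                       (≡.trans (≡.cong (_/ e) (sum-map-*ʳ e ys)) (m*n/n≡m (sum ys) e))
    binomial-factor : (sum ys + b) C sum ys ≡ ((n + 1) / e + ΣFin n m / e ∸ 1) C (ΣFin n m / e)
    binomial-factor = ≡.trans (≡.cong (_C sum ys) (ℕ.+-comm (sum ys) b))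
                              (≡.sym (≡.cong₂ (λ a s → (a + s ∸ 1) C s) [n+1]/e≡1+b Σm/e≡Σys))
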